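{- Let $G$ be a finite group and let $f$ be a map from the set of subgroups of $G$ to $\{0,1\}$ such that $f(A)\ge f(B)$ whenever $A\le B\le G$, and $f(A)=f(A^g)$ for all $A\le G$, $g\in G$. Let $t,u$ be integers with $t\mid u\mid |G|$ such that every subgroup of $G$ of order $u$ contains a normal subgroup of order $t$. Let $\mathcal{T}_N$ be a set containing exactly one representative $T$ of each $G$-conjugacy class of subgroups $T\le G$ of order $t$ with $f(T)=1$, and let $\mathcal{U}$ be the set of all subgroups $U'\le G$ with $|U'|=u$ such that $T\le U'\le N_G(T)$ for some $T\in\mathcal{T}_N$ (these are considered up to conjugation in $N_G(T)$). Then $f(U)=0$ for every subgroup $U\le G$ with $|U|=u$ that is not $G$-conjugate to any member of $\mathcal{U}$.
   Context: $A^g=g^{ -1}Ag$ denotes conjugation, and $N_G(T)$ is the normalizer of $T$ in $G$. -}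

module Defs where

open import Data.Nat using (ℕ)
open import Data.Bool using (Bool; true; false; _≟_)
open import Data.Fin using (Fin)
open import Data.Fin.Subset using (Subset; _∈_; _⊆_; ∣_∣)
open import Data.Vec using (tabulate; lookup)
open import Data.Vec.Properties using (≡-dec)
open import Data.Product using (Σ; _×_; ∃)
open import Relation.Nullary.Decidable using (⌊_⌋)
open import Relation.Binary.PropositionalEquality using (_≡_)
open import Algebra.Structures using (IsGroup)

-- A finite group of order n, represented (up to isomorphism) as a group
-- structure on the n-element set Fin n, with propositional equality.
record FinGroup (n : ℕ) : Set where
  infixl 7 _∙_
  field
    _∙_     : Fin n → Fin n → Fin n
    ε       : Fin n
    _⁻¹     : Fin n → Fin n
    isGroup : IsGroup _≡_ _∙_ ε _⁻¹

module _ {n : ℕ} (G : FinGroup n) where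
  open FinGroup G

  record IsSubgroup (H : Subset n) : Set where
    field
      ε-mem : ε ∈ H
      ∙-mem : ∀ {x y} → x ∈ H → y ∈ H → x ∙ y ∈ H
      ⁻¹-mem : ∀ {x} → x ∈ H → x ⁻¹ ∈ H

  -- Conjugate A^g = g⁻¹ A g :  x ∈ A^g  iff  g x g⁻¹ ∈ A.
  conj : Subset n → Fin n → Subset n
  conj A g = tabulate (λ x → lookup A (g ∙ x ∙ g ⁻¹))

  normalizer : Subset n → Subset n
  normalizer T = tabulate (λ g → ⌊ ≡-dec _≟_ (conj T g) T ⌋)

  NormalIn : Subset n → Subset n → Set
  NormalIn T U = IsSubgroup T × T ⊆ U × (∀ {x} → x ∈ U → conj T x ≡ T)

  Conjugate : Subset n → Subset n → Set
  Conjugate A B = ∃ λ g → conj A g ≡ B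

module Submission where

-- Suppose f U = 1 for a subgroup U of order u.  By hypothesis U
-- has a normal subgroup T of order t, and f T = 1 by monotonicity of f.  So T
-- is G-conjugate, say T^g = T′, to the representative T′ ∈ 𝒯_N of its class.
-- Conjugating the whole configuration by g, the subgroup U^g has order u,
-- contains T^g = T′ and normalises it, i.e. T′ ≤ U^g ≤ N_G(T′); hence U is
-- G-conjugate to a member of 𝒰, contrary to assumption.

open import Defs
open import Data.Nat using (ℕ; suc)
open import Data.Nat.Divisibility using (_∣_)
open import Data.Nat.Properties using (+-0-commutativeMonoid)
open import Data.Bool using (Bool; true; false)
import Data.Bool as Bool
open import Data.Fin using (Fin)
open import Data.Fin.Subset using (Subset; _∈_; _⊆_; ∣_∣)
open import Data.Fin.Permutation using (Permutation′; permutation; _⟨$⟩ʳ_)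
open import Data.Vec using ([]; _∷_; lookup; tabulate)
open import Data.Vec.Properties
  using (lookup∘tabulate; tabulate∘lookup; tabulate-cong; []=⇒lookup; lookup⇒[]=; ≡-dec)
open import Data.Product using (_×_; ∃; _,_)
open import Data.Empty using (⊥-elim)
open import Relation.Nullary using (¬_; yes; no)
open import Relation.Nullary.Decidable using (⌊_⌋)
open import Relation.Binary.PropositionalEquality
  using (_≡_; refl; sym; trans; cong; cong₂; subst; module ≡-Reasoning)
open import Algebra.Bundles using (Group)
import Algebra.Properties.Group as GroupProperties
import Algebra.Properties.CommutativeMonoid.Sum as Sum

open Sum +-0-commutativeMonoid using (sum; sum-permute; sum-cong-≗)

indicator : Bool → ℕ
indicator true  = 1
indicator false = 0

card-as-sum : ∀ {n} (A : Subset n) → ∣ A ∣ ≡ sum (λ i → indicator (lookup A i))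
card-as-sum []          = refl
card-as-sum (true ∷ A)  = cong suc (card-as-sum A)
card-as-sum (false ∷ A) = card-as-sum A

relabel : ∀ {n} → Subset n → Permutation′ n → Subset n
relabel A π = tabulate (λ x → lookup A (π ⟨$⟩ʳ x))

card-relabel : ∀ {n} (A : Subset n) (π : Permutation′ n) → ∣ relabel A π ∣ ≡ ∣ A ∣
card-relabel A π = begin
  ∣ relabel A π ∣                                  ≡⟨ card-as-sum (relabel A π) ⟩
  sum (λ i → indicator (lookup (relabel A π) i))   ≡⟨ sum-cong-≗ (λ i → cong indicator (lookup∘tabulate (λ x → lookup A (π ⟨$⟩ʳ x)) i)) ⟩
  sum (λ i → indicator (lookup A (π ⟨$⟩ʳ i)))       ≡⟨ sym (sum-permute (λ i → indicator (lookup A i)) π) ⟩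
  sum (λ i → indicator (lookup A i))               ≡⟨ sym (card-as-sum A) ⟩
  ∣ A ∣                                            ∎
  where open ≡-Reasoning

subset-ext : ∀ {n} (A B : Subset n) → (∀ i → lookup A i ≡ lookup B i) → A ≡ B
subset-ext A B same =
  trans (sym (tabulate∘lookup A)) (trans (tabulate-cong same) (tabulate∘lookup B))

module Conjugation {n : ℕ} (G : FinGroup n) where
  open FinGroup G

  asGroup : Group _ _
  asGroup = record { isGroup = isGroup }

  open Group asGroup using (assoc; identityˡ; identityʳ; inverseˡ; inverseʳ)
  open GroupProperties asGroup
    using (⁻¹-anti-homo-∙; ε⁻¹≈ε; ⁻¹-involutive)
  open ≡-Reasoning

  _▷_ : Fin n → Fin n → Fin n
  g ▷ x = g ∙ x ∙ g ⁻¹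

  lookup-conj : ∀ A g x → lookup (conj G A g) x ≡ lookup A (g ▷ x)
  lookup-conj A g x = lookup∘tabulate _ x

  ∈-conj : ∀ {A g x} → g ▷ x ∈ A → x ∈ conj G A g
  ∈-conj {A} {g} {x} m = lookup⇒[]= x _ (trans (lookup-conj A g x) ([]=⇒lookup m))

  conj-∈ : ∀ {A g x} → x ∈ conj G A g → g ▷ x ∈ A
  conj-∈ {A} {g} {x} m = lookup⇒[]= _ A (trans (sym (lookup-conj A g x)) ([]=⇒lookup m))

  ▷-compose : ∀ a b x → a ▷ (b ▷ x) ≡ (a ∙ b) ▷ x
  ▷-compose a b x = begin
    a ∙ (b ∙ x ∙ b ⁻¹) ∙ a ⁻¹   ≡⟨ cong (_∙ a ⁻¹) (sym (assoc a (b ∙ x) (b ⁻¹))) ⟩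
    a ∙ (b ∙ x) ∙ b ⁻¹ ∙ a ⁻¹   ≡⟨ assoc (a ∙ (b ∙ x)) (b ⁻¹) (a ⁻¹) ⟩
    a ∙ (b ∙ x) ∙ (b ⁻¹ ∙ a ⁻¹) ≡⟨ cong₂ _∙_ (sym (assoc a b x)) (sym (⁻¹-anti-homo-∙ a b)) ⟩
    a ∙ b ∙ x ∙ (a ∙ b) ⁻¹      ∎

  ▷-identity : ∀ x → ε ▷ x ≡ x
  ▷-identity x = trans (cong₂ _∙_ (identityˡ x) ε⁻¹≈ε) (identityʳ x)

  ▷-permutation : Fin n → Permutation′ n
  ▷-permutation g = permutation (g ▷_) (g ⁻¹ ▷_) (cancel g (g ⁻¹) (inverseʳ g))
                                                  (cancel (g ⁻¹) g (inverseˡ g))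
    where
    cancel : ∀ a b → a ∙ b ≡ ε → ∀ x → a ▷ (b ▷ x) ≡ x
    cancel a b ab≡ε x =
      trans (▷-compose a b x) (trans (cong (_▷ x) ab≡ε) (▷-identity x))

  ▷-∙ : ∀ g x y → g ▷ (x ∙ y) ≡ g ▷ x ∙ g ▷ y
  ▷-∙ g x y = begin
    g ∙ (x ∙ y) ∙ g ⁻¹                ≡⟨ cong (λ z → g ∙ (x ∙ z) ∙ g ⁻¹) (sym (identityˡ y)) ⟩
    g ∙ (x ∙ (ε ∙ y)) ∙ g ⁻¹          ≡⟨ cong (λ z → g ∙ (x ∙ (z ∙ y)) ∙ g ⁻¹) (sym (inverseˡ g)) ⟩
    g ∙ (x ∙ (g ⁻¹ ∙ g ∙ y)) ∙ g ⁻¹   ≡⟨ cong (λ z → g ∙ (x ∙ z) ∙ g ⁻¹) (assoc (g ⁻¹) g y) ⟩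
    g ∙ (x ∙ (g ⁻¹ ∙ (g ∙ y))) ∙ g ⁻¹ ≡⟨ cong (λ z → g ∙ z ∙ g ⁻¹) (sym (assoc x (g ⁻¹) (g ∙ y))) ⟩
    g ∙ (x ∙ g ⁻¹ ∙ (g ∙ y)) ∙ g ⁻¹   ≡⟨ cong (_∙ g ⁻¹) (sym (assoc g (x ∙ g ⁻¹) (g ∙ y))) ⟩
    g ∙ (x ∙ g ⁻¹) ∙ (g ∙ y) ∙ g ⁻¹   ≡⟨ cong (λ z → z ∙ (g ∙ y) ∙ g ⁻¹) (sym (assoc g x (g ⁻¹))) ⟩
    g ▷ x ∙ (g ∙ y) ∙ g ⁻¹            ≡⟨ assoc (g ▷ x) (g ∙ y) (g ⁻¹) ⟩
    g ▷ x ∙ g ▷ y                     ∎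

  ▷-ε : ∀ g → g ▷ ε ≡ ε
  ▷-ε g = trans (cong (_∙ g ⁻¹) (identityʳ g)) (inverseʳ g)

  ▷-⁻¹ : ∀ g x → g ▷ (x ⁻¹) ≡ (g ▷ x) ⁻¹
  ▷-⁻¹ g x = begin
    g ∙ x ⁻¹ ∙ g ⁻¹          ≡⟨ cong (λ z → z ∙ x ⁻¹ ∙ g ⁻¹) (sym (⁻¹-involutive g)) ⟩
    (g ⁻¹) ⁻¹ ∙ x ⁻¹ ∙ g ⁻¹  ≡⟨ cong (_∙ g ⁻¹) (sym (⁻¹-anti-homo-∙ x (g ⁻¹))) ⟩
    (x ∙ g ⁻¹) ⁻¹ ∙ g ⁻¹     ≡⟨ sym (⁻¹-anti-homo-∙ g (x ∙ g ⁻¹)) ⟩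
    (g ∙ (x ∙ g ⁻¹)) ⁻¹      ≡⟨ cong _⁻¹ (sym (assoc g x (g ⁻¹))) ⟩
    (g ▷ x) ⁻¹               ∎

  ▷-swap : ∀ g x → g ▷ x ∙ g ≡ g ∙ x
  ▷-swap g x = begin
    g ∙ x ∙ g ⁻¹ ∙ g   ≡⟨ assoc (g ∙ x) (g ⁻¹) g ⟩
    g ∙ x ∙ (g ⁻¹ ∙ g) ≡⟨ cong (g ∙ x ∙_) (inverseˡ g) ⟩
    g ∙ x ∙ ε          ≡⟨ identityʳ (g ∙ x) ⟩
    g ∙ x              ∎

  conj-conj : ∀ A g x → conj G (conj G A g) x ≡ conj G A (g ∙ x)
  conj-conj A g x = subset-ext _ _ λ y → begin
    lookup (conj G (conj G A g) x) y ≡⟨ lookup-conj (conj G A g) x y ⟩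
    lookup (conj G A g) (x ▷ y)      ≡⟨ lookup-conj A g (x ▷ y) ⟩
    lookup A (g ▷ (x ▷ y))           ≡⟨ cong (lookup A) (▷-compose g x y) ⟩
    lookup A ((g ∙ x) ▷ y)           ≡⟨ sym (lookup-conj A (g ∙ x) y) ⟩
    lookup (conj G A (g ∙ x)) y      ∎

  conj-subgroup : ∀ A g → IsSubgroup G A → IsSubgroup G (conj G A g)
  conj-subgroup A g sub = record
    { ε-mem  = ∈-conj (subst (_∈ A) (sym (▷-ε g)) ε-mem)
    ; ∙-mem  = λ {x} {y} x∈ y∈ →
        ∈-conj (subst (_∈ A) (sym (▷-∙ g x y)) (∙-mem (conj-∈ x∈) (conj-∈ y∈)))
    ; ⁻¹-mem = λ {x} x∈ → ∈-conj (subst (_∈ A) (sym (▷-⁻¹ g x)) (⁻¹-mem (conj-∈ x∈)))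
    }
    where open IsSubgroup sub

  conj-card : ∀ A g → ∣ conj G A g ∣ ≡ ∣ A ∣
  conj-card A g = card-relabel A (▷-permutation g)

  conj-⊆ : ∀ {A B} g → A ⊆ B → conj G A g ⊆ conj G B g
  conj-⊆ g A⊆B x∈ = ∈-conj (A⊆B (conj-∈ x∈))

  ∈-normalizer : ∀ {T x} → conj G T x ≡ T → x ∈ normalizer G T
  ∈-normalizer {T} {x} T^x≡T =
    lookup⇒[]= x _ (trans (lookup∘tabulate _ x) decided)
    where
    decided : ⌊ ≡-dec Bool._≟_ (conj G T x) T ⌋ ≡ true
    decided with ≡-dec Bool._≟_ (conj G T x) T
    ... | yes _    = refl
    ... | no T^x≢T = ⊥-elim (T^x≢T T^x≡T)

  conj-normalizes : ∀ {T U} g → (∀ {x} → x ∈ U → conj G T x ≡ T)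
    → conj G U g ⊆ normalizer G (conj G T g)
  conj-normalizes {T} g U-normalizes {x} x∈U^g = ∈-normalizer (begin
    conj G (conj G T g) x         ≡⟨ conj-conj T g x ⟩
    conj G T (g ∙ x)              ≡⟨ cong (conj G T) (sym (▷-swap g x)) ⟩
    conj G T (g ▷ x ∙ g)          ≡⟨ sym (conj-conj T (g ▷ x) g) ⟩
    conj G (conj G T (g ▷ x)) g   ≡⟨ cong (λ S → conj G S g) (U-normalizes (conj-∈ x∈U^g)) ⟩
    conj G T g                    ∎)

lemma1 : {n : ℕ} (G : FinGroup n) (f : Subset n → Bool)
    → (∀ A B → IsSubgroup G A → IsSubgroup G B → A ⊆ B → f B ≡ true → f A ≡ true)
    → (∀ A g → IsSubgroup G A → f A ≡ f (conj G A g))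
    → (t u : ℕ) → t ∣ u → u ∣ n
    → (∀ U → IsSubgroup G U → ∣ U ∣ ≡ u → ∃ λ T → NormalIn G T U × ∣ T ∣ ≡ t)
    → (TN : Subset n → Set)
    → (∀ T → TN T → IsSubgroup G T × ∣ T ∣ ≡ t × f T ≡ true)
    → (∀ T → IsSubgroup G T → ∣ T ∣ ≡ t → f T ≡ true → ∃ λ T′ → TN T′ × Conjugate G T T′)
    → (∀ T T′ → TN T → TN T′ → Conjugate G T T′ → T ≡ T′)
    → (U : Subset n) → IsSubgroup G U → ∣ U ∣ ≡ u
    → ¬ (∃ λ U′ → (IsSubgroup G U′ × ∣ U′ ∣ ≡ u
    × ∃ λ T → TN T × T ⊆ U′ × U′ ⊆ normalizer G T)
    × Conjugate G U U′)
    → f U ≡ false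
lemma1 G f mono _ t u _ _ hasNormal TN _ representative _ U U-sub U-order notInU
  with f U in fU
... | false = refl
... | true  with hasNormal U U-sub U-order
...   | T , (T-sub , T⊆U , U-normalizes) , T-order
      with representative T T-sub T-order (mono T U T-sub U-sub T⊆U fU)
...     | T′ , T′∈TN , g , T^g≡T′ =
  ⊥-elim (notInU (conj G U g , (U^g-sub , U^g-order , T′ , T′∈TN , T′⊆U^g , U^g⊆N[T′]) , g , refl))
  where
  open Conjugation G

  U^g-sub : IsSubgroup G (conj G U g)
  U^g-sub = conj-subgroup U g U-sub

  U^g-order : ∣ conj G U g ∣ ≡ u
  U^g-order = trans (conj-card U g) U-order

  T′⊆U^g : T′ ⊆ conj G U g
  T′⊆U^g = subst (_⊆ conj G U g) T^g≡T′ (conj-⊆ g T⊆U)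

  U^g⊆N[T′] : conj G U g ⊆ normalizer G T′
  U^g⊆N[T′] = subst (λ S → conj G U g ⊆ normalizer G S) T^g≡T′ (conj-normalizes g U-normalizes)
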